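{- Let $b,c$ be positive integers, let $(a_1,a_2)$ be a positive imaginary root, and let $(p,q)$ be a pair of positive integers with $q\le a_1$, $p\le a_2$. Let $(S_1,S_2)$ be the extremal pair of size $(q;p)$ in $\mathcal{D}^{a_1\times a_2}$. Then the following are equivalent: (1) every $u\in S_1$ precedes every $v\in S_2$ along the path; (2) $a_1p+a_2q<a_1a_2+a_1+a_2$.
   Context: A positive imaginary root is $(a_1,a_2)\in\mathbb{Z}_{>0}^2$ with $ca_1^2-bca_1a_2+ba_2^2\le0$. $\mathcal{D}^{a_1\times a_2}$ is the maximal Dyck path from $(0,0)$ to $(a_1,a_2)$: the lattice path with unit east/north steps never going above the segment from $(0,0)$ to $(a_1,a_2)$ such that every lattice point strictly above the path is strictly above that segment. Its horizontal edges are $u_1,\dots,u_{a_1}$ (left to right) and vertical edges $v_1,\dots,v_{a_2}$ (bottom to top). For $0\le s_1\le a_1$, $0\le s_2\le a_2$, the extremal pair of size $(s_1;s_2)$ is $(S_1,S_2)$ with $S_1=\{u_1,\dots,u_{s_1}\}$ and $S_2=\{v_{a_2-s_2+1},\dots,v_{a_2}\}$. -}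

module Defs where

open import Data.Nat using (ℕ; zero; suc; _+_; _*_; _∸_; _≤_; _<_)
open import Data.List using (List; []; _∷_; length; drop)
open import Data.Product using (_×_; _,_; ∃)
open import Data.List.Membership.Propositional using (_∈_)
open import Relation.Binary.PropositionalEquality using (_≡_)

data Step : Set where
  E N : Step

countE : List Step → ℕ
countE []      = 0
countE (E ∷ s) = suc (countE s)
countE (N ∷ s) = countE s

countN : List Step → ℕ
countN []      = 0
countN (E ∷ s) = countN s
countN (N ∷ s) = suc (countN s)

pointsFrom : ℕ → ℕ → List Step → List (ℕ × ℕ)
pointsFrom x y []      = (x , y) ∷ []
pointsFrom x y (E ∷ s) = (x , y) ∷ pointsFrom (suc x) y s
pointsFrom x y (N ∷ s) = (x , y) ∷ pointsFrom x (suc y) s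

vertices : List Step → List (ℕ × ℕ)
vertices = pointsFrom 0 0

-- Positive imaginary root: c a1² - b c a1 a2 + b a2² ≤ 0 (rearranged in ℕ).
PosImagRoot : ℕ → ℕ → ℕ → ℕ → Set
PosImagRoot b c a₁ a₂ =
  (0 < a₁) × (0 < a₂) × (c * (a₁ * a₁) + b * (a₂ * a₂) ≤ b * c * a₁ * a₂)

StrictlyAboveLine : ℕ → ℕ → ℕ → ℕ → Set
StrictlyAboveLine a₁ a₂ x y = x * a₂ < y * a₁

-- The maximal Dyck path D^{a1×a2}: a lattice path from (0,0) to (a1,a2)
-- with unit east/north steps, never going above the segment from (0,0)
-- to (a1,a2), such that every lattice point strictly above the path
-- (i.e. (x,y) with 0 ≤ x ≤ a1 and y larger than every height of the path
-- at abscissa x) is strictly above that segment.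
IsMaximalDyckPath : ℕ → ℕ → List Step → Set
IsMaximalDyckPath a₁ a₂ P =
  (countE P ≡ a₁) × (countN P ≡ a₂) ×
  (∀ x y → (x , y) ∈ vertices P → y * a₁ ≤ x * a₂) ×
  (∀ x y → x ≤ a₁ → (∀ y′ → (x , y′) ∈ vertices P → y′ < y) →
     StrictlyAboveLine a₁ a₂ x y)

StepAt : List Step → ℕ → Step → Set
StepAt P k s = ∃ λ rest → drop k P ≡ s ∷ rest

prefix : ℕ → List Step → List Step
prefix zero    _       = []
prefix (suc k) []      = []
prefix (suc k) (s ∷ P) = s ∷ prefix k P

-- The horizontal edge u_{i+1} (0-based index i) is the step at position k.
IsU : List Step → ℕ → ℕ → Set
IsU P i k = StepAt P k E × (countE (prefix k P) ≡ i)

-- The vertical edge v_{j+1} (0-based index j) is the step at position k.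
IsV : List Step → ℕ → ℕ → Set
IsV P j k = StepAt P k N × (countN (prefix k P) ≡ j)

-- Every u ∈ S1 = {u_1..u_q} precedes every v ∈ S2 = {v_{a2-p+1}..v_{a2}}
-- along the path P (0-based: u-indices i < q, v-indices a2-p ≤ j < a2).
ExtremalPairSeparated : ℕ → ℕ → ℕ → List Step → Set
ExtremalPairSeparated a₂ q p P =
  ∀ i j k l → i < q → a₂ ∸ p ≤ j → j < a₂ → IsU P i k → IsV P j l → k < l

-- Let k be the position of u_q and l that of v_{a₂−p+1}; by monotonicity of the
-- edge indices along the path, separation amounts to k < l.  If k < l, every
-- vertex in the column x = q − 1 has height at most a₂ − p, so maximality puts
-- (q − 1, a₂ − p + 1) strictly above the diagonal.  If l ≤ k, the upper end of
-- v_{a₂−p+1} is a vertex (x, a₂ − p + 1) with x ≤ q − 1, which is weakly below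
-- the diagonal.  So separation holds iff (q − 1) a₂ < (a₂ − p + 1) a₁, which is
-- condition (2) rearranged.
module Submission where

open import Defs
open import Data.Nat using (ℕ; zero; suc; _+_; _*_; _∸_; _≤_; _<_; z≤n; s≤s; _<?_)
open import Data.Nat.Properties
open import Data.Nat.Tactic.RingSolver using (solve-∀)
open import Data.List using (List; []; _∷_; length)
open import Data.List.Relation.Unary.Any using (here; there)
open import Data.List.Membership.Propositional using (_∈_)
open import Data.Product using (_×_; _,_; ∃)
open import Relation.Binary.PropositionalEquality
open import Relation.Nullary using (yes; no)
open import Data.Empty using (⊥-elim)
open import Function.Bundles using (_⇔_; mk⇔; module Equivalence)

private
  variable
    P : List Step
    s : Step
    m n a₁ a₂ : ℕ

∈-pointsFrom⇒prefix : ∀ x y P → (m , n) ∈ pointsFrom x y P →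
  ∃ λ r → m ≡ x + countE (prefix r P) × n ≡ y + countN (prefix r P)
∈-pointsFrom⇒prefix x y []      (here refl) = 0 , sym (+-identityʳ x) , sym (+-identityʳ y)
∈-pointsFrom⇒prefix x y (E ∷ _) (here refl) = 0 , sym (+-identityʳ x) , sym (+-identityʳ y)
∈-pointsFrom⇒prefix x y (N ∷ _) (here refl) = 0 , sym (+-identityʳ x) , sym (+-identityʳ y)
∈-pointsFrom⇒prefix x y (E ∷ P) (there mem) with ∈-pointsFrom⇒prefix (suc x) y P mem
... | r , eqˣ , eqʸ = suc r , trans eqˣ (sym (+-suc x _)) , eqʸ
∈-pointsFrom⇒prefix x y (N ∷ P) (there mem) with ∈-pointsFrom⇒prefix x (suc y) P mem
... | r , eqˣ , eqʸ = suc r , eqˣ , trans eqʸ (sym (+-suc y _))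

prefix∈pointsFrom : ∀ x y P r → r ≤ length P →
  (x + countE (prefix r P) , y + countN (prefix r P)) ∈ pointsFrom x y P
prefix∈pointsFrom x y []      zero _ rewrite +-identityʳ x | +-identityʳ y = here refl
prefix∈pointsFrom x y (E ∷ _) zero _ rewrite +-identityʳ x | +-identityʳ y = here refl
prefix∈pointsFrom x y (N ∷ _) zero _ rewrite +-identityʳ x | +-identityʳ y = here refl
prefix∈pointsFrom x y (E ∷ P) (suc r) (s≤s r≤) rewrite +-suc x (countE (prefix r P)) =
  there (prefix∈pointsFrom (suc x) y P r r≤)
prefix∈pointsFrom x y (N ∷ P) (suc r) (s≤s r≤) rewrite +-suc y (countN (prefix r P)) =
  there (prefix∈pointsFrom x (suc y) P r r≤)

countE-prefix-mono : ∀ P → m ≤ n → countE (prefix m P) ≤ countE (prefix n P)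
countE-prefix-mono {zero}          P       _         = z≤n
countE-prefix-mono {suc _} {suc _} []      _         = z≤n
countE-prefix-mono {suc _} {suc _} (E ∷ P) (s≤s m≤n) = s≤s (countE-prefix-mono P m≤n)
countE-prefix-mono {suc _} {suc _} (N ∷ P) (s≤s m≤n) = countE-prefix-mono P m≤n

countN-prefix-mono : ∀ P → m ≤ n → countN (prefix m P) ≤ countN (prefix n P)
countN-prefix-mono {zero}          P       _         = z≤n
countN-prefix-mono {suc _} {suc _} []      _         = z≤n
countN-prefix-mono {suc _} {suc _} (E ∷ P) (s≤s m≤n) = countN-prefix-mono P m≤n
countN-prefix-mono {suc _} {suc _} (N ∷ P) (s≤s m≤n) = s≤s (countN-prefix-mono P m≤n)

countE-prefix-≤ : ∀ m P → countE (prefix m P) ≤ countE P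
countE-prefix-≤ zero    P       = z≤n
countE-prefix-≤ (suc m) []      = z≤n
countE-prefix-≤ (suc m) (E ∷ P) = s≤s (countE-prefix-≤ m P)
countE-prefix-≤ (suc m) (N ∷ P) = countE-prefix-≤ m P

StepAt⇒< : ∀ k P → StepAt P k s → k < length P
StepAt⇒< zero    (_ ∷ _) _       = s≤s z≤n
StepAt⇒< (suc k) (_ ∷ P) stepAt = s≤s (StepAt⇒< k P stepAt)

countE-prefix-suc-E : ∀ k P → StepAt P k E →
  countE (prefix (suc k) P) ≡ suc (countE (prefix k P))
countE-prefix-suc-E zero    (_ ∷ _) (_ , refl) = refl
countE-prefix-suc-E (suc k) (E ∷ P) stepAt     = cong suc (countE-prefix-suc-E k P stepAt)
countE-prefix-suc-E (suc k) (N ∷ P) stepAt     = countE-prefix-suc-E k P stepAt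

countE-prefix-suc-N : ∀ k P → StepAt P k N →
  countE (prefix (suc k) P) ≡ countE (prefix k P)
countE-prefix-suc-N zero    (_ ∷ _) (_ , refl) = refl
countE-prefix-suc-N (suc k) (E ∷ P) stepAt     = cong suc (countE-prefix-suc-N k P stepAt)
countE-prefix-suc-N (suc k) (N ∷ P) stepAt     = countE-prefix-suc-N k P stepAt

countN-prefix-suc-N : ∀ k P → StepAt P k N →
  countN (prefix (suc k) P) ≡ suc (countN (prefix k P))
countN-prefix-suc-N zero    (_ ∷ _) (_ , refl) = refl
countN-prefix-suc-N (suc k) (E ∷ P) stepAt     = countN-prefix-suc-N k P stepAt
countN-prefix-suc-N (suc k) (N ∷ P) stepAt     = cong suc (countN-prefix-suc-N k P stepAt)

IsU-exists : ∀ P i → i < countE P → ∃ (IsU P i)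
IsU-exists (E ∷ P) zero    _         = 0 , (P , refl) , refl
IsU-exists (E ∷ P) (suc i) (s≤s i<) with IsU-exists P i i<
... | k , stepAt , index = suc k , stepAt , cong suc index
IsU-exists (N ∷ P) i       i<        with IsU-exists P i i<
... | k , stepAt , index = suc k , stepAt , index

IsV-exists : ∀ P j → j < countN P → ∃ (IsV P j)
IsV-exists (N ∷ P) zero    _         = 0 , (P , refl) , refl
IsV-exists (N ∷ P) (suc j) (s≤s j<) with IsV-exists P j j<
... | l , stepAt , index = suc l , stepAt , cong suc index
IsV-exists (E ∷ P) j       j<        with IsV-exists P j j<
... | l , stepAt , index = suc l , stepAt , index

IsU⇒index<countE : ∀ P {i} k → IsU P i k → i < countE P
IsU⇒index<countE P k (stepAt , refl) =
  subst (_≤ countE P) (countE-prefix-suc-E k P stepAt) (countE-prefix-≤ (suc k) P)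

-- The upper end of v_{j+1} is a vertex at height j + 1, hence weakly below the diagonal.
IsV-after-IsU⇒below : ∀ {i j k l} → IsMaximalDyckPath a₁ a₂ P → IsU P i k → IsV P j l → l ≤ k →
  suc j * a₁ ≤ i * a₂
IsV-after-IsU⇒below {a₁} {a₂} {P} {i} {j} {k} {l} (_ , _ , below , _) (_ , refl) (stepAt , refl) l≤k =
  begin
    suc j * a₁                          ≡⟨ cong (_* a₁) (sym (countN-prefix-suc-N l P stepAt)) ⟩
    countN (prefix (suc l) P) * a₁      ≤⟨ below _ _ (prefix∈pointsFrom 0 0 P (suc l) (StepAt⇒< l P stepAt)) ⟩
    countE (prefix (suc l) P) * a₂      ≡⟨ cong (_* a₂) (countE-prefix-suc-N l P stepAt) ⟩
    countE (prefix l P) * a₂            ≤⟨ *-monoˡ-≤ a₂ (countE-prefix-mono P l≤k) ⟩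
    countE (prefix k P) * a₂            ∎
  where open ≤-Reasoning

-- Vertices in column i all precede the step u_{i+1}, hence v_{j+1}, so (i , j + 1) is above the path.
IsU-before-IsV⇒above : ∀ {i j k l} → IsMaximalDyckPath a₁ a₂ P → IsU P i k → IsV P j l → k < l →
  i * a₂ < suc j * a₁
IsU-before-IsV⇒above {a₁} {a₂} {P} {i} {j} {k} {l} (countE≡a₁ , _ , _ , maximal) u@(stepAtᵘ , indexᵘ) (_ , indexᵛ) k<l =
  maximal i (suc j) (<⇒≤ (subst (i <_) countE≡a₁ (IsU⇒index<countE P k u))) column-below
  where
  column-below : ∀ y → (i , y) ∈ vertices P → y < suc j
  column-below y mem with ∈-pointsFrom⇒prefix 0 0 P mem
  ... | r , i≡ , refl with r <? suc k
  ... | yes r≤k = s≤s (subst (countN (prefix r P) ≤_) indexᵛ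
                        (countN-prefix-mono P (≤-trans (≤-pred r≤k) (<⇒≤ k<l))))
  ... | no r≰k  = ⊥-elim (n≮n i (begin-strict
          i                           <⟨ n<1+n i ⟩
          suc i                       ≡⟨ cong suc (sym indexᵘ) ⟩
          suc (countE (prefix k P))   ≡⟨ sym (countE-prefix-suc-E k P stepAtᵘ) ⟩
          countE (prefix (suc k) P)   ≤⟨ countE-prefix-mono P (≮⇒≥ r≰k) ⟩
          countE (prefix r P)         ≡⟨ sym i≡ ⟩
          i                           ∎))
    where open ≤-Reasoning

-- Writing a₂ = j + p, both sides of (2) contain a₁ p + a₂, which then cancels.
criterion⇔ : ∀ a₁ a₂ p i → p ≤ a₂ →
  (a₁ * p + a₂ * suc i < a₁ * a₂ + a₁ + a₂) ⇔ (i * a₂ < suc (a₂ ∸ p) * a₁)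
criterion⇔ a₁ a₂ p i p≤a₂ =
  mk⇔ (λ lt → +-cancelˡ-< (a₁ * p + a₂) _ _ (subst₂ _<_ (lhs≡ a₁ a₂ p i) rhs≡ lt))
      (λ lt → subst₂ _<_ (sym (lhs≡ a₁ a₂ p i)) (sym rhs≡) (+-monoʳ-< (a₁ * p + a₂) lt))
  where
  lhs≡ : ∀ a₁ a₂ p i → a₁ * p + a₂ * suc i ≡ a₁ * p + a₂ + i * a₂
  lhs≡ = solve-∀
  rhs-split : ∀ a₁ a₂ p j → a₁ * (j + p) + a₁ + a₂ ≡ a₁ * p + a₂ + suc j * a₁
  rhs-split = solve-∀
  rhs≡ : a₁ * a₂ + a₁ + a₂ ≡ a₁ * p + a₂ + suc (a₂ ∸ p) * a₁
  rhs≡ = begin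
    a₁ * a₂ + a₁ + a₂                 ≡⟨ cong (λ z → a₁ * z + a₁ + a₂) (sym (m∸n+n≡m p≤a₂)) ⟩
    a₁ * (a₂ ∸ p + p) + a₁ + a₂       ≡⟨ rhs-split a₁ a₂ p (a₂ ∸ p) ⟩
    a₁ * p + a₂ + suc (a₂ ∸ p) * a₁   ∎
    where open ≡-Reasoning

lemma3p3 : (b c a₁ a₂ p q : ℕ) → 0 < b → 0 < c → PosImagRoot b c a₁ a₂ →
    0 < p → 0 < q → q ≤ a₁ → p ≤ a₂ →
    (P : List Step) → IsMaximalDyckPath a₁ a₂ P →
    ExtremalPairSeparated a₂ q p P ⇔ (a₁ * p + a₂ * q < a₁ * a₂ + a₁ + a₂)
lemma3p3 _ _ a₁ a₂ p (suc i) _ _ _ 0<p _ q≤a₁ p≤a₂ P dyck@(countE≡a₁ , countN≡a₂ , _) =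
  mk⇔ (λ sep → Equivalence.from criterion (separated⇒above sep))
      (λ lt → above⇒separated (Equivalence.to criterion lt))
  where
  j : ℕ
  j = a₂ ∸ p

  criterion : (a₁ * p + a₂ * suc i < a₁ * a₂ + a₁ + a₂) ⇔ (i * a₂ < suc j * a₁)
  criterion = criterion⇔ a₁ a₂ p i p≤a₂

  j<a₂ : j < a₂
  j<a₂ = ∸-monoʳ-< 0<p p≤a₂

  separated⇒above : ExtremalPairSeparated a₂ (suc i) p P → i * a₂ < suc j * a₁
  separated⇒above sep with IsU-exists P i (subst (i <_) (sym countE≡a₁) q≤a₁)
                         | IsV-exists P j (subst (j <_) (sym countN≡a₂) j<a₂)
  ... | k , u | l , v = IsU-before-IsV⇒above dyck u v (sep i j k l ≤-refl ≤-refl j<a₂ u v)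

  above⇒separated : i * a₂ < suc j * a₁ → ExtremalPairSeparated a₂ (suc i) p P
  above⇒separated lt i′ j′ k l i′<q j≤j′ _ u v with k <? l
  ... | yes k<l = k<l
  ... | no k≮l  = ⊥-elim (<⇒≱ lt (begin
          suc j * a₁    ≤⟨ *-monoˡ-≤ a₁ (s≤s j≤j′) ⟩
          suc j′ * a₁   ≤⟨ IsV-after-IsU⇒below dyck u v (≮⇒≥ k≮l) ⟩
          i′ * a₂       ≤⟨ *-monoˡ-≤ a₂ (≤-pred i′<q) ⟩
          i * a₂        ∎))
    where open ≤-Reasoning
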